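{- Let $m\ge 2$ and $a_1,\dots,a_m\ge1$ be integers, $N=a_1+\dots+a_m$, and $\bar A=N-\max_j a_j$. Let $\sigma^2=\frac{(e_1+1)e_2-e_3}{12}$, where $e_k$ is the $k$-th elementary symmetric polynomial of $a_1,\dots,a_m$. Then $$\frac{N^2\bar A}{36}\le \sigma^2\le \frac{(N+1)N\bar A}{12}\le \frac{N^2\bar A}{6}.$$
   Context: The quantity $\sigma^2$ equals the variance of the number of inversions of a uniformly random word over $\{1,\dots,m\}$ containing exactly $a_i$ copies of letter $i$ (an inversion being a pair of positions $i<j$ with $w_i>w_j$). -}

module Defs where

open import Data.Nat using (ℕ; zero; suc; _+_; _*_; _⊔_)
open import Data.List using (List; []; _∷_; foldr)
open import Data.Nat.ListAction using (sum)
open import Data.Integer using (ℤ; +_; _-_)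
import Data.Integer as ℤ
open import Data.Rational using (ℚ; _/_)

esym : ℕ → List ℕ → ℕ
esym zero    _        = 1
esym (suc k) []       = 0
esym (suc k) (x ∷ xs) = esym (suc k) xs + x * esym k xs

totalN : List ℕ → ℕ
totalN = sum

maxList : List ℕ → ℕ
maxList = foldr _⊔_ 0

Abar : List ℕ → ℤ
Abar as = + totalN as - + maxList as

sigma2 : List ℕ → ℚ
sigma2 as = (+ ((esym 1 as + 1) * esym 2 as) - + esym 3 as) / 12

-- With N = e₁, M the largest part and Ā = N − M, three inequalities between elementary
-- symmetric polynomials, each by induction on the list,
--   N Ā ≤ 2 e₂ ≤ 2 N Ā,   3 e₃ ≤ N e₂,
-- squeeze 12 σ² = (N + 1) e₂ − e₃: from below, (N + 1) e₂ − e₃ ≥ 2 N e₂ / 3 ≥ N² Ā / 3;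
-- from above, (N + 1) e₂ − e₃ ≤ (N + 1) N Ā. The last bound is just N + 1 ≤ 2 N when N ≥ 1.
module Submission where

open import Defs
open import Data.Nat using (ℕ; _≥_)
import Data.Nat as ℕ
open import Data.List using (List; length)
open import Data.List.Relation.Unary.All using (All)
open import Data.Product using (_×_)
open import Data.Integer using (+_)
import Data.Integer as ℤ
open import Data.Rational using (ℚ; _≤_; _/_)

open import Data.Nat using (zero; suc; _+_; _*_; _∸_; _⊔_; z≤n)
open import Data.List using ([]; _∷_)
open import Data.Product using (_,_)
open import Data.Sum using (inj₁; inj₂)
open import Relation.Binary.PropositionalEquality
  using (_≡_; refl; sym; trans; cong; cong₂; subst₂)
open import Data.Nat.Properties
import Data.Integer.Properties as ℤP
import Data.Rational.Properties as ℚP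
import Data.Rational.Unnormalised as ℚᵘ
import Data.Rational.Unnormalised.Properties as ℚᵘP
open import Data.Nat.Tactic.RingSolver using (solve)

*≤*⇒/≤/ : ∀ p q {m n} → p ℤ.* + suc n ℤ.≤ q ℤ.* + suc m → p / suc m ≤ q / suc n
*≤*⇒/≤/ p q {m} {n} le = ℚP.toℚᵘ-cancel-≤
  (ℚᵘP.≤-respˡ-≃ (ℚᵘP.≃-sym (ℚP.toℚᵘ-fromℚᵘ (ℚᵘ.mkℚᵘ p m)))
    (ℚᵘP.≤-respʳ-≃ (ℚᵘP.≃-sym (ℚP.toℚᵘ-fromℚᵘ (ℚᵘ.mkℚᵘ q n))) (ℚᵘ.*≤* le)))

+/≤+/ : ∀ a b {m n} → a * suc n ℕ.≤ b * suc m → + a / suc m ≤ + b / suc n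
+/≤+/ a b {m} {n} le =
  *≤*⇒/≤/ (+ a) (+ b) (subst₂ ℤ._≤_ (ℤP.pos-* a (suc n)) (ℤP.pos-* b (suc m)) (ℤ.+≤+ le))

+m-+n≡+[m∸n] : ∀ {m n} → n ℕ.≤ m → + m ℤ.- + n ≡ + (m ∸ n)
+m-+n≡+[m∸n] {m} {n} n≤m = trans (ℤP.m-n≡m⊖n m n) (ℤP.⊖-≥ n≤m)

open ≤-Reasoning

esym1≡totalN : ∀ as → esym 1 as ≡ totalN as
esym1≡totalN []       = refl
esym1≡totalN (x ∷ xs) =
  trans (cong₂ _+_ (esym1≡totalN xs) (*-identityʳ x)) (+-comm (totalN xs) x)

esym2-∷ : ∀ x xs → esym 2 (x ∷ xs) ≡ esym 2 xs + x * totalN xs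
esym2-∷ x xs = cong (λ n → esym 2 xs + x * n) (esym1≡totalN xs)

maxList≤totalN : ∀ as → maxList as ℕ.≤ totalN as
maxList≤totalN []       = z≤n
maxList≤totalN (x ∷ xs) =
  ⊔-lub (m≤m+n x (totalN xs)) (≤-trans (maxList≤totalN xs) (m≤n+m (totalN xs) x))

2*esym2≤totalN*totalN : ∀ as → 2 * esym 2 as ℕ.≤ totalN as * totalN as
2*esym2≤totalN*totalN []       = z≤n
2*esym2≤totalN*totalN (x ∷ xs) rewrite esym2-∷ x xs
  with totalN xs | esym 2 xs | 2*esym2≤totalN*totalN xs
... | n | e | 2e≤n*n = begin
  2 * (e + x * n)            ≡⟨ solve (x ∷ n ∷ e ∷ []) ⟩
  2 * e + 2 * x * n          ≤⟨ +-monoˡ-≤ _ 2e≤n*n ⟩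
  n * n + 2 * x * n          ≤⟨ m≤m+n _ (x * x) ⟩
  n * n + 2 * x * n + x * x  ≡⟨ solve (x ∷ n ∷ []) ⟩
  (x + n) * (x + n)          ∎

totalN*totalN≤totalN*maxList+2*esym2 :
  ∀ as → totalN as * totalN as ℕ.≤ totalN as * maxList as + 2 * esym 2 as
totalN*totalN≤totalN*maxList+2*esym2 []       = z≤n
totalN*totalN≤totalN*maxList+2*esym2 (x ∷ xs) rewrite esym2-∷ x xs
  with totalN xs | esym 2 xs | maxList xs | totalN*totalN≤totalN*maxList+2*esym2 xs
... | n | e | m | n*n≤n*m+2e with x ⊔ m | m≤m⊔n x m | m≤n⊔m x m
... | k | x≤k | m≤k = begin
  (x + n) * (x + n)                    ≡⟨ solve (x ∷ n ∷ []) ⟩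
  x * x + 2 * x * n + n * n            ≤⟨ +-monoʳ-≤ _ n*n≤n*m+2e ⟩
  x * x + 2 * x * n + (n * m + 2 * e)
    ≤⟨ +-mono-≤ (+-monoˡ-≤ _ (*-monoʳ-≤ x x≤k)) (+-monoˡ-≤ _ (*-monoʳ-≤ n m≤k)) ⟩
  x * k + 2 * x * n + (n * k + 2 * e)  ≡⟨ solve (x ∷ n ∷ e ∷ k ∷ []) ⟩
  (x + n) * k + 2 * (e + x * n)        ∎

esym2+totalN*maxList≤totalN*totalN :
  ∀ as → esym 2 as + totalN as * maxList as ℕ.≤ totalN as * totalN as
esym2+totalN*maxList≤totalN*totalN []       = z≤n
esym2+totalN*maxList≤totalN*totalN (x ∷ xs) rewrite esym2-∷ x xs
  with totalN xs | esym 2 xs | maxList xs | maxList≤totalN xs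
     | esym2+totalN*maxList≤totalN*totalN xs
... | n | e | m | m≤n | e+n*m≤n*n with ≤-total m x
... | inj₁ m≤x rewrite m≥n⇒m⊔n≡m m≤x = begin
  e + x * n + (x + n) * x        ≤⟨ +-monoˡ-≤ _ (+-monoˡ-≤ _ (m+n≤o⇒m≤o e e+n*m≤n*n)) ⟩
  n * n + x * n + (x + n) * x    ≡⟨ solve (x ∷ n ∷ []) ⟩
  (x + n) * (x + n)              ∎
... | inj₂ x≤m rewrite m≤n⇒m⊔n≡n x≤m = begin
  e + x * n + (x + n) * m        ≡⟨ solve (x ∷ n ∷ e ∷ m ∷ []) ⟩
  (e + n * m) + x * n + x * m
    ≤⟨ +-mono-≤ (+-monoˡ-≤ _ e+n*m≤n*n) (*-monoʳ-≤ x (≤-trans m≤n (m≤n+m n x))) ⟩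
  n * n + x * n + x * (x + n)    ≡⟨ solve (x ∷ n ∷ []) ⟩
  (x + n) * (x + n)              ∎

3*esym3≤totalN*esym2 : ∀ as → 3 * esym 3 as ℕ.≤ totalN as * esym 2 as
3*esym3≤totalN*esym2 []       = z≤n
3*esym3≤totalN*esym2 (x ∷ xs) rewrite esym2-∷ x xs
  with totalN xs | esym 2 xs | esym 3 xs | 2*esym2≤totalN*totalN xs
     | 3*esym3≤totalN*esym2 xs
... | n | e | f | 2e≤n*n | 3f≤n*e = begin
  3 * (f + x * e)                              ≡⟨ solve (x ∷ e ∷ f ∷ []) ⟩
  3 * f + x * e + x * (2 * e)
    ≤⟨ +-mono-≤ (+-monoˡ-≤ _ 3f≤n*e) (*-monoʳ-≤ x 2e≤n*n) ⟩
  n * e + x * e + x * (n * n)                  ≤⟨ m≤m+n _ (x * x * n) ⟩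
  n * e + x * e + x * (n * n) + x * x * n      ≡⟨ solve (x ∷ n ∷ e ∷ []) ⟩
  (x + n) * (e + x * n)                        ∎

totalN*Ā≤2*esym2 : ∀ as → totalN as * (totalN as ∸ maxList as) ℕ.≤ 2 * esym 2 as
totalN*Ā≤2*esym2 as rewrite *-distribˡ-∸ (totalN as) (totalN as) (maxList as) =
  m≤n+o⇒m∸n≤o (totalN as * totalN as) (totalN as * maxList as)
    (totalN*totalN≤totalN*maxList+2*esym2 as)

esym2≤totalN*Ā : ∀ as → esym 2 as ℕ.≤ totalN as * (totalN as ∸ maxList as)
esym2≤totalN*Ā as rewrite *-distribˡ-∸ (totalN as) (totalN as) (maxList as) =
  m+n≤o⇒m≤o∸n _ (esym2+totalN*maxList≤totalN*totalN as)

f≤[N+1]*e : ∀ N e f → 3 * f ℕ.≤ N * e → f ℕ.≤ (N + 1) * e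
f≤[N+1]*e N e f 3*f≤N*e = begin
  f            ≤⟨ m≤n*m f 3 ⟩
  3 * f        ≤⟨ 3*f≤N*e ⟩
  N * e        ≤⟨ *-monoˡ-≤ e (m≤m+n N 1) ⟩
  (N + 1) * e  ∎

N*N*a≤3*[[N+1]*e∸f] : ∀ N a e f → N * a ℕ.≤ 2 * e → 3 * f ℕ.≤ N * e →
                      N * N * a ℕ.≤ 3 * ((N + 1) * e ∸ f)
N*N*a≤3*[[N+1]*e∸f] N a e f N*a≤2*e 3*f≤N*e
  rewrite *-distribˡ-∸ 3 ((N + 1) * e) f = m+n≤o⇒m≤o∸n (N * N * a) (begin
    N * N * a + 3 * f    ≡⟨ cong (_+ 3 * f) (*-assoc N N a) ⟩
    N * (N * a) + 3 * f  ≤⟨ +-mono-≤ (*-monoʳ-≤ N N*a≤2*e) 3*f≤N*e ⟩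
    N * (2 * e) + N * e  ≡⟨ solve (N ∷ e ∷ []) ⟩
    3 * (N * e)          ≤⟨ *-monoʳ-≤ 3 (*-monoˡ-≤ e (m≤m+n N 1)) ⟩
    3 * ((N + 1) * e)    ∎)

[N+1]*e∸f≤[N+1]*N*a : ∀ N a e f → e ℕ.≤ N * a → (N + 1) * e ∸ f ℕ.≤ (N + 1) * N * a
[N+1]*e∸f≤[N+1]*N*a N a e f e≤N*a = begin
  (N + 1) * e ∸ f    ≤⟨ m∸n≤m _ f ⟩
  (N + 1) * e        ≤⟨ *-monoʳ-≤ (N + 1) e≤N*a ⟩
  (N + 1) * (N * a)  ≡⟨ *-assoc (N + 1) N a ⟨
  (N + 1) * N * a    ∎

[n+1]*n≤2*[n*n] : ∀ n → (n + 1) * n ℕ.≤ 2 * (n * n)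
[n+1]*n≤2*[n*n] zero    = z≤n
[n+1]*n≤2*[n*n] (suc k) = begin
  (suc k + 1) * suc k            ≡⟨ solve (k ∷ []) ⟩
  suc k * suc k + suc k          ≤⟨ +-monoʳ-≤ (suc k * suc k) (m≤m*n (suc k) (suc k)) ⟩
  suc k * suc k + suc k * suc k  ≡⟨ solve (k ∷ []) ⟩
  2 * (suc k * suc k)            ∎

sigma2-bounds : ∀ N a e f → N * a ℕ.≤ 2 * e → e ℕ.≤ N * a → 3 * f ℕ.≤ N * e →
  (+ (N * N * a) / 36 ≤ + ((N + 1) * e ∸ f) / 12)
  × (+ ((N + 1) * e ∸ f) / 12 ≤ + ((N + 1) * N * a) / 12)
  × (+ ((N + 1) * N * a) / 12 ≤ + (N * N * a) / 6)
sigma2-bounds N a e f N*a≤2*e e≤N*a 3*f≤N*e =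
    +/≤+/ (N * N * a) s (begin
      N * N * a * 12  ≤⟨ *-monoˡ-≤ 12 (N*N*a≤3*[[N+1]*e∸f] N a e f N*a≤2*e 3*f≤N*e) ⟩
      3 * s * 12      ≡⟨ trans (cong (_* 12) (*-comm 3 s)) (*-assoc s 3 12) ⟩
      s * 36          ∎)
  , +/≤+/ s ((N + 1) * N * a) (*-monoˡ-≤ 12 ([N+1]*e∸f≤[N+1]*N*a N a e f e≤N*a))
  , +/≤+/ ((N + 1) * N * a) (N * N * a) (begin
      (N + 1) * N * a * 6    ≤⟨ *-monoˡ-≤ 6 (*-monoˡ-≤ a ([n+1]*n≤2*[n*n] N)) ⟩
      2 * (N * N) * a * 6    ≡⟨ solve (N ∷ a ∷ []) ⟩
      N * N * a * 12         ∎)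
  where s = (N + 1) * e ∸ f

Abar≡+[totalN∸maxList] : ∀ as → Abar as ≡ + (totalN as ∸ maxList as)
Abar≡+[totalN∸maxList] as = +m-+n≡+[m∸n] (maxList≤totalN as)

sigma2≡+[[totalN+1]*esym2∸esym3]/12 :
  ∀ as → sigma2 as ≡ + ((totalN as + 1) * esym 2 as ∸ esym 3 as) / 12
sigma2≡+[[totalN+1]*esym2∸esym3]/12 as = trans
  (cong (λ N → (+ ((N + 1) * esym 2 as) ℤ.- + esym 3 as) / 12) (esym1≡totalN as))
  (cong (_/ 12) (+m-+n≡+[m∸n] (f≤[N+1]*e (totalN as) (esym 2 as) (esym 3 as)
                                (3*esym3≤totalN*esym2 as))))

lemma3p1 : (as : List ℕ) → length as ≥ 2 → All (λ a → a ≥ 1) as →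
    (ℤ._*_ (+ (totalN as ℕ.* totalN as)) (Abar as) / 36 ≤ sigma2 as)
    × (sigma2 as ≤ ℤ._*_ (+ ((totalN as ℕ.+ 1) ℕ.* totalN as)) (Abar as) / 12)
    × (ℤ._*_ (+ ((totalN as ℕ.+ 1) ℕ.* totalN as)) (Abar as) / 12
    ≤ ℤ._*_ (+ (totalN as ℕ.* totalN as)) (Abar as) / 6)
lemma3p1 as _ _
  rewrite Abar≡+[totalN∸maxList] as | sigma2≡+[[totalN+1]*esym2∸esym3]/12 as
        | sym (ℤP.pos-* (totalN as * totalN as) (totalN as ∸ maxList as))
        | sym (ℤP.pos-* ((totalN as + 1) * totalN as) (totalN as ∸ maxList as))
  = sigma2-bounds (totalN as) (totalN as ∸ maxList as) (esym 2 as) (esym 3 as)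
      (totalN*Ā≤2*esym2 as) (esym2≤totalN*Ā as) (3*esym3≤totalN*esym2 as)
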